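{- Let $A=(a_{i,j})$ be the skew-symmetric matrix with rows and columns indexed by the totally ordered set $\{0<0'<1<2<\cdots\}$, with entries \[ a_{0,0'} = 0,\quad a_{0,j} = 1+u,\quad a_{0',j} = (-1)^{j-1} (1-u),\quad a_{i,j} = \begin{cases} 1 + u^2, &\text{if } j - i \text{ is odd},\\ 2 u, &\text{if } j - i \text{ is even},\end{cases} \] for positive integers $i<j$, where $u$ is an indeterminate. Then: (1) For every partition $\mu$ of length at most $2h$, \[ \operatorname{Pf} A^{I_{2h}(\mu)} = 2^{h-1} \left( u^{r(\mu)} + u^{2h-r(\mu)} \right),\qquad \operatorname{Pf} A^{(0,0') \sqcup I_{2h}(\mu)} = 2^h \left( u^{r(\mu)} - u^{2h-r(\mu)} \right). \] (2) For every partition $\mu$ of length at most $2h+1$, \[ \operatorname{Pf} A^{(0) \sqcup I_{2h+1}(\mu)} = 2^h \left( u^{r(\mu)} + u^{2h+1 - r(\mu)} \right),\qquad \operatorname{Pf} A^{(0') \sqcup I_{2h+1}(\mu)} = 2^h \left( u^{r(\mu)} - u^{2h+1 - r(\mu)} \right). \]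
   Context: For a partition $\mu=(\mu_1\ge\mu_2\ge\cdots)$ of length at most $m$ (with $\mu_i=0$ for $i$ beyond the length), $I_m(\mu)=(\mu_m+1,\mu_{m-1}+2,\dots,\mu_1+m)$, an increasing sequence of positive integers. $r(\mu)$ is the number of $i$ with $\mu_i$ odd. For a sequence $R=(r_1,\dots,r_p)$ of indices, $A^R=(a_{r_i,r_j})_{1\le i,j\le p}$, and $(r_1,\dots,r_p)\sqcup(r'_1,\dots,r'_{p'})=(r_1,\dots,r_p,r'_1,\dots,r'_{p'})$ denotes concatenation. $\operatorname{Pf}$ is the Pfaffian. Here $h$ is a nonnegative integer in (1) (with $h\ge 1$ where needed for the first formula) and a nonnegative integer in (2). -}

module Defs where

open import Level using (Level)
open import Data.Nat using (ℕ; zero; suc)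
import Data.Nat as ℕ
open import Data.Bool using (Bool; true; false; if_then_else_; not)
open import Data.Fin using (Fin; toℕ)
import Data.Fin as Fin
open import Data.Vec using (Vec; []; _∷_; lookup; removeAt; reverse; zipWith; tabulate; count)
open import Algebra.Bundles using (CommutativeRing)
import Algebra.Definitions.RawSemiring as RS
open import Relation.Nullary.Decidable using (Dec; yes; no)

isOdd : ℕ → Bool
isOdd zero = false
isOdd (suc n) = not (isOdd n)

-- The totally ordered index set {0 < 0' < 1 < 2 < ...}:
-- o is 0, o' is 0', pos n is the positive integer n (only used with n ≥ 1).
data Idx : Set where
  o  : Idx
  o' : Idx
  pos : ℕ → Idx

-- Partitions of length at most m: weakly decreasing vectors (μ_1,…,μ_m)
-- of naturals (trailing zeros allowed).
IsPartition : ∀ {m} → Vec ℕ m → Set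
IsPartition {m} μ = ∀ (i j : Fin m) → i Fin.≤ j → lookup μ j ℕ.≤ lookup μ i

oddCount : ∀ {m} → Vec ℕ m → ℕ
oddCount μ = count (λ x → Data.Bool._≟_ (isOdd x) true) μ

-- I_m(μ) = (μ_m + 1, μ_{m-1} + 2, …, μ_1 + m)
I : ∀ {m} → Vec ℕ m → Vec Idx m
I μ = zipWith (λ x k → pos (x ℕ.+ k)) (reverse μ) (tabulate (λ k → suc (toℕ k)))

module Matrix {c ℓ : Level} (R : CommutativeRing c ℓ) (u : CommutativeRing.Carrier R) where
  open CommutativeRing R
  open import Algebra.Bundles using (Semiring)
  open RS (Semiring.rawSemiring semiring) public using (_^_)

  two : Carrier
  two = 1# + 1#

  aPos : ℕ → ℕ → Carrier
  aPos i j = if isOdd (j ℕ.∸ i) then 1# + u * u else two * u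

  a : Idx → Idx → Carrier
  a o o = 0#
  a o o' = 0#
  a o' o = - 0#
  a o' o' = 0#
  a o (pos j) = 1# + u
  a (pos j) o = - (1# + u)
  a o' (pos j) = if isOdd (j ℕ.∸ 1) then - (1# - u) else 1# - u
  a (pos j) o' = - (if isOdd (j ℕ.∸ 1) then - (1# - u) else 1# - u)
  a (pos i) (pos j) with i ℕ.<ᵇ j | j ℕ.<ᵇ i
  ... | true | _ = aPos i j
  ... | false | true = - aPos j i
  ... | false | false = 0#

  sumFin : ∀ {n} → (Fin n → Carrier) → Carrier
  sumFin {zero} f = 0#
  sumFin {suc n} f = f Fin.zero + sumFin (λ k → f (Fin.suc k))

  Pf : ∀ {p} → Vec Idx p → Carrier
  Pf [] = 1#
  Pf (r ∷ []) = 0#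
  Pf (r ∷ rs@(_ ∷ _)) =
    sumFin (λ k → ((- 1#) ^ toℕ k) * (a r (lookup rs k) * Pf (removeAt rs k)))

-- For positive i < j the entry a_{i,j} factorises as η_i ξ_j + ξ_i η_j, where ξ_j = 1, η_j = u
-- for odd j and ξ_j = u, η_j = 1 for even j; on positive indices the rows of 0 and 0' are
-- ξ + η and ξ − η.  Expanding such a Pfaffian along its first row leaves the alternating
-- sums Σ_k (−1)^k F(r_k) Π_{fg}(R ∖ r_k) of the alternating products
-- Π_{fg}(r_1, …, r_m) = f(r_1) g(r_2) f(r_3) ⋯, which telescope: for m odd they equal
-- Π_{FF'}(R), F' being the other weight; for m even they vanish if f = F and equal
-- Π_{FF'}(R) − Π_{F'F}(R) otherwise.  Inductively, Pf A^R = 2^{h−1}(Π_{ξη}(R) + Π_{ηξ}(R))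
-- for |R| = 2h, and the bordered Pfaffians follow the same way.  In I_m(μ) the k-th entry is
-- μ_{m+1−k} + k, so it contributes a factor u to Π_{ξη} exactly when μ_{m+1−k} is odd:
-- Π_{ξη} = u^{r(μ)} and Π_{ηξ} = u^{m−r(μ)}.

module Submission where

open import Defs
open import Level using (Level)
open import Data.Bool using (Bool; true; false; not; _xor_; if_then_else_)
open import Data.Bool.Properties using (not-distribˡ-xor; xor-annihilates-not; not-involutive)
open import Data.Empty using (⊥)
import Data.Bool as Bool
open import Data.Fin using (Fin; toℕ)
import Data.Fin as Fin
open import Data.Nat using (ℕ; zero; suc; z≤n; s≤s)
import Data.Nat as ℕ
import Data.Nat.Properties as ℕₚ
open import Data.Product using (_×_; _,_)
open import Data.Vec using (Vec; []; _∷_; lookup; removeAt; reverse; zipWith; tabulate; count; _∷ʳ_)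
open import Data.Vec.Properties using (reverse-∷; tabulate-cong)
open import Data.Vec.Relation.Unary.All using (All; []; _∷_)
import Data.Vec.Relation.Unary.All as All
open import Data.Vec.Relation.Unary.All.Properties using (lookup⁺; lookup⁻)
open import Data.Vec.Relation.Unary.AllPairs using (AllPairs; []; _∷_)
open import Function using (flip; id)
import Relation.Binary.PropositionalEquality as ≡
open ≡ using (_≡_)
open import Relation.Nullary.Decidable using (does)
open import Relation.Unary using (Pred; Decidable)
open import Relation.Binary.Core using (Rel)
open import Algebra.Bundles using (CommutativeRing)

double : ℕ → ℕ
double zero = zero
double (suc h) = suc (suc (double h))

double≡2* : ∀ h → double h ≡ 2 ℕ.* h
double≡2* zero = ≡.refl
double≡2* (suc h) = ≡.cong suc (≡.trans (≡.cong suc (double≡2* h)) (≡.sym (ℕₚ.+-suc h (h ℕ.+ 0))))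

module _ {a} {A : Set a} where
  open ≡ using (refl; sym; trans; cong; subst)

  All-removeAt : ∀ {p} {P : Pred A p} {n} {xs : Vec A (suc n)} → All P xs → ∀ k → All P (removeAt xs k)
  All-removeAt (_ ∷ pxs) Fin.zero = pxs
  All-removeAt {xs = _ ∷ _ ∷ _} (px ∷ pxs) (Fin.suc k) = px ∷ All-removeAt pxs k

  AllPairs-removeAt : ∀ {r} {R : Rel A r} {n} {xs : Vec A (suc n)} → AllPairs R xs → ∀ k → AllPairs R (removeAt xs k)
  AllPairs-removeAt (_ ∷ rxs) Fin.zero = rxs
  AllPairs-removeAt {xs = _ ∷ _ ∷ _} (rx ∷ rxs) (Fin.suc k) = All-removeAt rx k ∷ AllPairs-removeAt rxs k

  All-∷ʳ : ∀ {p} {P : Pred A p} {n} {xs : Vec A n} {x} → All P xs → P x → All P (xs ∷ʳ x)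
  All-∷ʳ [] px = px ∷ []
  All-∷ʳ (py ∷ pys) px = py ∷ All-∷ʳ pys px

  All-reverse : ∀ {p} {P : Pred A p} {n} {xs : Vec A n} → All P xs → All P (reverse xs)
  All-reverse [] = []
  All-reverse {P = P} {xs = x ∷ xs} (px ∷ pxs) = subst (All P) (sym (reverse-∷ x xs)) (All-∷ʳ (All-reverse pxs) px)

  AllPairs-∷ʳ : ∀ {r} {R : Rel A r} {n} {xs : Vec A n} {x} → AllPairs R xs → All (λ y → R y x) xs → AllPairs R (xs ∷ʳ x)
  AllPairs-∷ʳ [] [] = [] ∷ []
  AllPairs-∷ʳ (ry ∷ rys) (py ∷ pys) = All-∷ʳ ry py ∷ AllPairs-∷ʳ rys pys

  AllPairs-reverse : ∀ {r} {R : Rel A r} {n} {xs : Vec A n} → AllPairs R xs → AllPairs (flip R) (reverse xs)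
  AllPairs-reverse [] = []
  AllPairs-reverse {R = R} {xs = x ∷ xs} (rx ∷ rxs) =
    subst (AllPairs (flip R)) (sym (reverse-∷ x xs)) (AllPairs-∷ʳ (AllPairs-reverse rxs) (All-reverse rx))

  module _ {p} {P : Pred A p} (P? : Decidable P) where

    count-∷ʳ : ∀ {n} (xs : Vec A n) x → count P? (xs ∷ʳ x) ≡ count P? (x ∷ xs)
    count-∷ʳ [] x = refl
    count-∷ʳ (y ∷ xs) x rewrite count-∷ʳ xs x with does (P? x) | does (P? y)
    ... | true  | true  = refl
    ... | true  | false = refl
    ... | false | true  = refl
    ... | false | false = refl

    count-reverse : ∀ {n} (xs : Vec A n) → count P? (reverse xs) ≡ count P? xs
    count-reverse [] = refl
    count-reverse (x ∷ xs) rewrite reverse-∷ x xs | count-∷ʳ (reverse xs) x | count-reverse xs = refl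

  count-true+count-false : ∀ (p : A → Bool) {n} (xs : Vec A n) →
    count (λ a → p a Bool.≟ true) xs ℕ.+ count (λ a → p a Bool.≟ false) xs ≡ n
  count-true+count-false p [] = refl
  count-true+count-false p (x ∷ xs) with p x
  ... | true  = cong suc (count-true+count-false p xs)
  ... | false = trans (ℕₚ.+-suc _ _) (cong suc (count-true+count-false p xs))

isOdd-+ : ∀ m n → isOdd (m ℕ.+ n) ≡ isOdd m xor isOdd n
isOdd-+ zero n = ≡.refl
isOdd-+ (suc m) n = ≡.trans (≡.cong not (isOdd-+ m n)) (not-distribˡ-xor (isOdd m) (isOdd n))

isOdd-∸ : ∀ {i j} → i ℕ.≤ j → isOdd (j ℕ.∸ i) ≡ isOdd i xor isOdd j
isOdd-∸ {zero} _ = ≡.refl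
isOdd-∸ {suc i} {suc j} (s≤s i≤j) = ≡.trans (isOdd-∸ i≤j) (≡.sym (xor-annihilates-not (isOdd i) (isOdd j)))

partition⇒antitone : ∀ {n} {μ : Vec ℕ n} → IsPartition μ → AllPairs (flip ℕ._≤_) μ
partition⇒antitone {μ = []} _ = []
partition⇒antitone {μ = _ ∷ _} isP =
  lookup⁻ (λ j → isP Fin.zero (Fin.suc j) z≤n) ∷ partition⇒antitone (λ i j i≤j → isP (Fin.suc i) (Fin.suc j) (s≤s i≤j))

Above : ℕ → Idx → Set
Above i (pos j) = i ℕ.< j
Above i o = ⊥
Above i o' = ⊥

staircase : ℕ → ∀ {n} → Vec ℕ n → Vec Idx n
staircase k [] = []
staircase k (a ∷ ν) = pos (a ℕ.+ k) ∷ staircase (suc k) ν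

zipWith-tabulate≡staircase : ∀ k {n} (ν : Vec ℕ n) →
  zipWith (λ a i → pos (a ℕ.+ i)) ν (tabulate (λ i → k ℕ.+ toℕ i)) ≡ staircase k ν
zipWith-tabulate≡staircase k [] = ≡.refl
zipWith-tabulate≡staircase k (a ∷ ν) = ≡.cong₂ _∷_
  (≡.cong (λ i → pos (a ℕ.+ i)) (ℕₚ.+-identityʳ k))
  (≡.trans (≡.cong (zipWith _ ν) (tabulate-cong (λ i → ℕₚ.+-suc k (toℕ i)))) (zipWith-tabulate≡staircase (suc k) ν))

I≡staircase : ∀ {n} (μ : Vec ℕ n) → I μ ≡ staircase 1 (reverse μ)
I≡staircase μ = zipWith-tabulate≡staircase 1 (reverse μ)

staircase-above : ∀ {i a} k {n} (ν : Vec ℕ n) → All (a ℕ.≤_) ν → i ℕ.≤ a ℕ.+ k → All (Above i) (staircase (suc k) ν)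
staircase-above k [] [] _ = []
staircase-above {a = a} k (b ∷ ν) (a≤b ∷ a≤ν) i≤a+k =
  ℕₚ.≤-<-trans i≤a+k (ℕₚ.+-mono-≤-< a≤b (ℕₚ.n<1+n k)) ∷
  staircase-above (suc k) ν a≤ν (ℕₚ.≤-trans i≤a+k (ℕₚ.+-monoʳ-≤ a (ℕₚ.n≤1+n k)))

module SignedSums {c ℓ : Level} (R : CommutativeRing c ℓ) where
  open CommutativeRing R
  open import Algebra.Bundles using (Semiring)
  open import Algebra.Definitions.RawSemiring (Semiring.rawSemiring semiring) using (_^_)
  open import Algebra.Properties.Semiring.Sum semiring using (sum; sum-cong-≋; ∑-distrib-+; *-distribˡ-sum)
  open import Algebra.Properties.Ring ring using (-1*x≈-x)
  open import Relation.Binary.Reasoning.Setoid setoid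

  sign : ∀ {n} → Fin n → Carrier
  sign k = (- 1#) ^ toℕ k

  ∑-sign-suc : ∀ {n} (t : Fin n → Carrier) → sum (λ k → sign (Fin.suc k) * t k) ≈ - sum (λ k → sign k * t k)
  ∑-sign-suc t = begin
    sum (λ k → (- 1# * sign k) * t k)   ≈⟨ sum-cong-≋ (λ k → *-assoc (- 1#) (sign k) (t k)) ⟩
    sum (λ k → - 1# * (sign k * t k))   ≈⟨ *-distribˡ-sum (- 1#) (λ k → sign k * t k) ⟨
    - 1# * sum (λ k → sign k * t k)     ≈⟨ -1*x≈-x _ ⟩
    - sum (λ k → sign k * t k)          ∎

  ∑-linear₄ : ∀ {n} a b c d (s t v w : Fin n → Carrier) →
    sum (λ k → a * s k + b * t k + c * v k + d * w k) ≈ a * sum s + b * sum t + c * sum v + d * sum w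
  ∑-linear₄ a b c d s t v w =
    trans (∑-distrib-+ _ (λ k → d * w k)) (+-cong
      (trans (∑-distrib-+ _ (λ k → c * v k)) (+-cong
        (trans (∑-distrib-+ (λ k → a * s k) (λ k → b * t k)) (+-cong (∑-scale a s) (∑-scale b t)))
        (∑-scale c v)))
      (∑-scale d w))
    where
      ∑-scale : ∀ a (t : Fin _ → Carrier) → sum (λ k → a * t k) ≈ a * sum t
      ∑-scale a t = sym (*-distribˡ-sum a t)

module AlternatingExpansion {c ℓ : Level} (R : CommutativeRing c ℓ) {X : Set} where
  open CommutativeRing R
  open SignedSums R
  open import Algebra.Properties.Semiring.Sum semiring using (sum; sum-cong-≋; *-distribˡ-sum)
  open import Algebra.Properties.Ring ring using (x[y-z]≈xy-xz)
  open import Algebra.Properties.AbelianGroup +-abelianGroup using (⁻¹-anti-homo‿-; xyx⁻¹≈y)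
  open import Algebra.Properties.Group +-group using (ε⁻¹≈ε)
  open import Algebra.Solver.Ring.NaturalCoefficients.Default commutativeSemiring using (solve; _:=_; _:+_; _:*_)
  open import Relation.Binary.Reasoning.Setoid setoid

  alt : (X → Carrier) → (X → Carrier) → ∀ {n} → Vec X n → Carrier
  alt f g [] = 1#
  alt f g (r ∷ L) = f r * alt g f L

  expand : (X → Carrier) → (X → Carrier) → (X → Carrier) → ∀ {n} → Vec X (suc n) → Carrier
  expand F f g L = sum (λ k → sign k * (F (lookup L k) * alt f g (removeAt L k)))

  expand-∷ : ∀ F f g r {n} (L : Vec X (suc n)) → expand F f g (r ∷ L) ≈ F r * alt f g L - f r * expand F g f L
  expand-∷ F f g r L@(_ ∷ _) = +-cong (*-identityˡ _) (begin
    sum (λ k → sign (Fin.suc k) * (F (lookup L k) * (f r * alt g f (removeAt L k))))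
      ≈⟨ ∑-sign-suc (λ k → F (lookup L k) * (f r * alt g f (removeAt L k))) ⟩
    - sum (λ k → sign k * (F (lookup L k) * (f r * alt g f (removeAt L k))))
      ≈⟨ -‿cong (sum-cong-≋ (λ k → pull (sign k) (F (lookup L k)) (f r) (alt g f (removeAt L k)))) ⟩
    - sum (λ k → f r * (sign k * (F (lookup L k) * alt g f (removeAt L k))))
      ≈⟨ -‿cong (*-distribˡ-sum (f r) (λ k → sign k * (F (lookup L k) * alt g f (removeAt L k)))) ⟨
    - (f r * expand F g f L) ∎)
    where
      pull : ∀ s a b t → s * (a * (b * t)) ≈ b * (s * (a * t))
      pull = solve 4 (λ s a b t → s :* (a :* (b :* t)) := b :* (s :* (a :* t))) refl

  expand-singleton : ∀ F f g r → expand F f g (r ∷ []) ≈ F r * 1#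
  expand-singleton F f g r = trans (+-identityʳ _) (*-identityˡ _)

  private
    x*y-x*[y-z]≈x*z : ∀ x y z → x * y - x * (y - z) ≈ x * z
    x*y-x*[y-z]≈x*z x y z = begin
      x * y - x * (y - z)   ≈⟨ x[y-z]≈xy-xz x y (y - z) ⟨
      x * (y - (y - z))     ≈⟨ *-congˡ (+-congˡ (⁻¹-anti-homo‿- y z)) ⟩
      x * (y + (z - y))     ≈⟨ *-congˡ (+-assoc y z (- y)) ⟨
      x * (y + z - y)       ≈⟨ *-congˡ (xyx⁻¹≈y y z) ⟩
      x * z                 ∎

    x-y*0≈x : ∀ x y → x - y * 0# ≈ x
    x-y*0≈x x y = trans (+-congˡ (trans (-‿cong (zeroʳ y)) ε⁻¹≈ε)) (+-identityʳ x)

  expand-odd-same   : ∀ h f g (L : Vec X (suc (double h))) → expand f f g L ≈ alt f g L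
  expand-odd-other  : ∀ h f g (L : Vec X (suc (double h))) → expand f g f L ≈ alt f g L
  expand-even-same  : ∀ h f g (L : Vec X (double (suc h))) → expand f f g L ≈ 0#
  expand-even-other : ∀ h f g (L : Vec X (double (suc h))) → expand f g f L ≈ alt f g L - alt g f L

  expand-odd-same zero f g (r ∷ []) = expand-singleton f f g r
  expand-odd-same (suc h) f g (r ∷ L) = begin
    expand f f g (r ∷ L)                             ≈⟨ expand-∷ f f g r L ⟩
    f r * alt f g L - f r * expand f g f L           ≈⟨ +-congˡ (-‿cong (*-congˡ (expand-even-other h f g L))) ⟩
    f r * alt f g L - f r * (alt f g L - alt g f L)  ≈⟨ x*y-x*[y-z]≈x*z (f r) (alt f g L) (alt g f L) ⟩
    f r * alt g f L                                  ∎

  expand-odd-other zero f g (r ∷ []) = expand-singleton f g f r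
  expand-odd-other (suc h) f g (r ∷ L) = begin
    expand f g f (r ∷ L)                    ≈⟨ expand-∷ f g f r L ⟩
    f r * alt g f L - g r * expand f f g L  ≈⟨ +-congˡ (-‿cong (*-congˡ (expand-even-same h f g L))) ⟩
    f r * alt g f L - g r * 0#              ≈⟨ x-y*0≈x (f r * alt g f L) (g r) ⟩
    f r * alt g f L                         ∎

  expand-even-same h f g (r ∷ L) = begin
    expand f f g (r ∷ L)                    ≈⟨ expand-∷ f f g r L ⟩
    f r * alt f g L - f r * expand f g f L  ≈⟨ +-congˡ (-‿cong (*-congˡ (expand-odd-other h f g L))) ⟩
    f r * alt f g L - f r * alt f g L       ≈⟨ -‿inverseʳ _ ⟩
    0#                                      ∎

  expand-even-other h f g (r ∷ L) = begin
    expand f g f (r ∷ L)                    ≈⟨ expand-∷ f g f r L ⟩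
    f r * alt g f L - g r * expand f f g L  ≈⟨ +-congˡ (-‿cong (*-congˡ (expand-odd-same h f g L))) ⟩
    f r * alt g f L - g r * alt f g L       ∎

  expand-bilinear : ∀ {n} (L : Vec X (suc n)) f g {α β γ δ c} (M N : Fin (suc n) → Carrier) →
    (∀ k → M k ≈ α * f (lookup L k) + β * g (lookup L k)) →
    (∀ k → N k ≈ c * (γ * alt f g (removeAt L k) + δ * alt g f (removeAt L k))) →
    sum (λ k → sign k * (M k * N k)) ≈
      c * (α * γ * expand f f g L + α * δ * expand f g f L + β * γ * expand g f g L + β * δ * expand g g f L)
  expand-bilinear L f g {α} {β} {γ} {δ} {c} M N M≈ N≈ = begin
    sum (λ k → sign k * (M k * N k))
      ≈⟨ sum-cong-≋ (λ k → trans (*-congˡ (*-cong (M≈ k) (N≈ k)))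
           (distribute α β γ δ c (sign k) (f (lookup L k)) (g (lookup L k))
                                  (alt f g (removeAt L k)) (alt g f (removeAt L k)))) ⟩
    sum (λ k → c * combination k)        ≈⟨ *-distribˡ-sum c combination ⟨
    c * sum combination
      ≈⟨ *-congˡ (∑-linear₄ _ _ _ _ (term f f g) (term f g f) (term g f g) (term g g f)) ⟩
    c * (α * γ * expand f f g L + α * δ * expand f g f L + β * γ * expand g f g L + β * δ * expand g g f L) ∎
    where
      term : (X → Carrier) → (X → Carrier) → (X → Carrier) → Fin _ → Carrier
      term F f′ g′ k = sign k * (F (lookup L k) * alt f′ g′ (removeAt L k))
      combination : Fin _ → Carrier
      combination k = α * γ * term f f g k + α * δ * term f g f k + β * γ * term g f g k + β * δ * term g g f k
      distribute : ∀ α β γ δ c s x y P Q → s * ((α * x + β * y) * (c * (γ * P + δ * Q))) ≈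
        c * (α * γ * (s * (x * P)) + α * δ * (s * (x * Q)) + β * γ * (s * (y * P)) + β * δ * (s * (y * Q)))
      distribute = solve 10 (λ α β γ δ c s x y P Q →
        s :* ((α :* x :+ β :* y) :* (c :* (γ :* P :+ δ :* Q))) :=
        c :* (α :* γ :* (s :* (x :* P)) :+ α :* δ :* (s :* (x :* Q)) :+ β :* γ :* (s :* (y :* P)) :+ β :* δ :* (s :* (y :* Q))))
        refl

module FactorisedPfaffian {c ℓ : Level} (R : CommutativeRing c ℓ) (u : CommutativeRing.Carrier R)
                          (x y : Idx → CommutativeRing.Carrier R) where
  open CommutativeRing R
  open Matrix R u
  open SignedSums R
  open AlternatingExpansion R
  open import Algebra.Properties.Semiring.Sum semiring using (sum)
  open import Algebra.Properties.Ring ring using (-‿distribˡ-*; -‿distribʳ-*; [y-z]x≈yx-zx)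
  open import Algebra.Properties.AbelianGroup +-abelianGroup using (⁻¹-anti-homo‿-)
  open import Algebra.Solver.Ring.NaturalCoefficients.Default commutativeSemiring using (solve; _:=_; _:+_; _:*_; con)
  open import Relation.Binary.Reasoning.Setoid setoid

  Row : Idx → Carrier → Carrier → ∀ {n} → Vec Idx n → Set ℓ
  Row r α β = All (λ s → a r s ≈ α * x s + β * y s)

  Factorised : ∀ {n} → Vec Idx n → Set ℓ
  Factorised = AllPairs (λ r s → a r s ≈ y r * x s + x r * y s)

  private
    +-cong₄ : ∀ {p p′ q q′ r r′ s s′} → p ≈ p′ → q ≈ q′ → r ≈ r′ → s ≈ s′ → p + q + r + s ≈ p′ + q′ + r′ + s′
    +-cong₄ e₁ e₂ e₃ e₄ = +-cong (+-cong (+-cong e₁ e₂) e₃) e₄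

  sumFin≡sum : ∀ {n} (t : Fin n → Carrier) → sumFin t ≡ sum t
  sumFin≡sum {zero} t = ≡.refl
  sumFin≡sum {suc n} t = ≡.cong (t Fin.zero +_) (sumFin≡sum (λ k → t (Fin.suc k)))

  Pf-row  : ∀ h {r α β} (L : Vec Idx (suc (double h))) → Factorised L → Row r α β L →
            Pf (r ∷ L) ≈ two ^ h * (α * alt x y L + β * alt y x L)
  Pf-even : ∀ h (L : Vec Idx (double (suc h))) → Factorised L → Pf L ≈ two ^ h * (alt x y L + alt y x L)

  Pf-row zero {r} {α} {β} (s ∷ []) _ (rs ∷ []) = begin
    1# * (a r s * 1#) + 0#         ≈⟨ trans (+-identityʳ _) (trans (*-identityˡ _) (*-identityʳ _)) ⟩
    a r s                          ≈⟨ rs ⟩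
    α * x s + β * y s              ≈⟨ unit α β (x s) (y s) ⟩
    1# * (α * (x s * 1#) + β * (y s * 1#)) ∎
    where
      unit : ∀ α β X Y → α * X + β * Y ≈ 1# * (α * (X * 1#) + β * (Y * 1#))
      unit = solve 4 (λ α β X Y → α :* X :+ β :* Y := con 1 :* (α :* (X :* con 1) :+ β :* (Y :* con 1))) refl
  Pf-row (suc h) {r} {α} {β} L@(_ ∷ _) fac row = begin
    Pf (r ∷ L)
      ≡⟨ sumFin≡sum (λ k → sign k * (a r (lookup L k) * Pf (removeAt L k))) ⟩
    sum (λ k → sign k * (a r (lookup L k) * Pf (removeAt L k)))
      ≈⟨ expand-bilinear L x y _ _ (lookup⁺ row) minor ⟩
    two ^ h * (α * 1# * expand x x y L + α * 1# * expand x y x L + β * 1# * expand y x y L + β * 1# * expand y y x L)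
      ≈⟨ *-congˡ (+-cong₄ (*-congˡ (expand-odd-same (suc h) x y L)) (*-congˡ (expand-odd-other (suc h) x y L))
                          (*-congˡ (expand-odd-other (suc h) y x L)) (*-congˡ (expand-odd-same (suc h) y x L))) ⟩
    two ^ h * (α * 1# * P + α * 1# * P + β * 1# * Q + β * 1# * Q)
      ≈⟨ collect (two ^ h) α β P Q ⟩
    two * two ^ h * (α * P + β * Q) ∎
    where
      P Q : Carrier
      P = alt x y L
      Q = alt y x L
      minor : ∀ k → Pf (removeAt L k) ≈ two ^ h * (1# * alt x y (removeAt L k) + 1# * alt y x (removeAt L k))
      minor k = trans (Pf-even h (removeAt L k) (AllPairs-removeAt fac k))
                      (*-congˡ (sym (+-cong (*-identityˡ _) (*-identityˡ _))))
      collect : ∀ c α β P Q → c * (α * 1# * P + α * 1# * P + β * 1# * Q + β * 1# * Q) ≈ (1# + 1#) * c * (α * P + β * Q)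
      collect = solve 5 (λ c α β P Q → c :* (α :* con 1 :* P :+ α :* con 1 :* P :+ β :* con 1 :* Q :+ β :* con 1 :* Q)
                                        := (con 1 :+ con 1) :* c :* (α :* P :+ β :* Q)) refl

  Pf-even h (r ∷ L) (row ∷ fac) = trans (Pf-row h L fac row) (*-congˡ (+-comm _ _))

  Pf-pair : ∀ h {r r' α β γ δ} (L : Vec Idx (double (suc h))) →
            a r r' ≈ 0# → Factorised L → Row r α β L → Row r' γ δ L →
            Pf (r ∷ r' ∷ L) ≈ two ^ h * ((β * γ - α * δ) * (alt x y L - alt y x L))
  Pf-pair h {r} {r'} {α} {β} {γ} {δ} L@(_ ∷ _) arr'≈0 fac row row' = begin
    1# * (a r r' * Pf L) + sumFin (λ k → sign (Fin.suc k) * T k)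
      ≡⟨ ≡.cong (1# * (a r r' * Pf L) +_) (sumFin≡sum (λ k → sign (Fin.suc k) * T k)) ⟩
    1# * (a r r' * Pf L) + sum (λ k → sign (Fin.suc k) * T k)
      ≈⟨ +-cong (trans (*-identityˡ _) (trans (*-congʳ arr'≈0) (zeroˡ _))) (∑-sign-suc T) ⟩
    0# - sum (λ k → sign k * T k)
      ≈⟨ +-identityˡ _ ⟩
    - sum (λ k → sign k * T k)
      ≈⟨ -‿cong (expand-bilinear L x y _ _ (lookup⁺ row) minor) ⟩
    - (two ^ h * (α * γ * expand x x y L + α * δ * expand x y x L + β * γ * expand y x y L + β * δ * expand y y x L))
      ≈⟨ -‿cong (*-congˡ (+-cong₄ (*-congˡ (expand-even-same h x y L)) (*-congˡ (expand-even-other h x y L))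
                                  (*-congˡ (expand-even-other h y x L)) (*-congˡ (expand-even-same h y x L)))) ⟩
    - (two ^ h * (α * γ * 0# + α * δ * (P - Q) + β * γ * (Q - P) + β * δ * 0#))
      ≈⟨ simplify (two ^ h) (α * γ) (α * δ) (β * γ) (β * δ) ⟩
    two ^ h * ((β * γ - α * δ) * (P - Q)) ∎
    where
      P Q : Carrier
      P = alt x y L
      Q = alt y x L
      T : Fin _ → Carrier
      T k = a r (lookup L k) * Pf (r' ∷ removeAt L k)
      minor : ∀ k → Pf (r' ∷ removeAt L k) ≈ two ^ h * (γ * alt x y (removeAt L k) + δ * alt y x (removeAt L k))
      minor k = Pf-row h (removeAt L k) (AllPairs-removeAt fac k) (All-removeAt row' k)
      drop-zeros : ∀ p q s t → p * 0# + q + s + t * 0# ≈ q + s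
      drop-zeros = solve 4 (λ p q s t → p :* con 0 :+ q :+ s :+ t :* con 0 := q :+ s) refl
      simplify : ∀ c αγ αδ βγ βδ →
        - (c * (αγ * 0# + αδ * (P - Q) + βγ * (Q - P) + βδ * 0#)) ≈ c * ((βγ - αδ) * (P - Q))
      simplify c αγ αδ βγ βδ = begin
        - (c * (αγ * 0# + αδ * (P - Q) + βγ * (Q - P) + βδ * 0#))
          ≈⟨ -‿cong (*-congˡ (+-congʳ (+-congˡ
               (trans (*-congˡ (sym (⁻¹-anti-homo‿- P Q))) (sym (-‿distribʳ-* βγ (P - Q))))))) ⟩
        - (c * (αγ * 0# + αδ * (P - Q) - βγ * (P - Q) + βδ * 0#))
          ≈⟨ -‿cong (*-congˡ (drop-zeros αγ (αδ * (P - Q)) (- (βγ * (P - Q))) βδ)) ⟩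
        - (c * (αδ * (P - Q) - βγ * (P - Q)))
          ≈⟨ -‿cong (*-congˡ ([y-z]x≈yx-zx (P - Q) αδ βγ)) ⟨
        - (c * ((αδ - βγ) * (P - Q)))
          ≈⟨ -‿distribʳ-* c _ ⟩
        c * - ((αδ - βγ) * (P - Q))
          ≈⟨ *-congˡ (-‿distribˡ-* (αδ - βγ) (P - Q)) ⟩
        c * (- (αδ - βγ) * (P - Q))
          ≈⟨ *-congˡ (*-congʳ (⁻¹-anti-homo‿- αδ βγ)) ⟩
        c * ((βγ - αδ) * (P - Q)) ∎

module StaircaseMinors {c ℓ : Level} (R : CommutativeRing c ℓ) (u : CommutativeRing.Carrier R) where
  open CommutativeRing R
  open Matrix R u
  open import Algebra.Properties.Ring ring using (-1*x≈-x)
  open import Algebra.Properties.AbelianGroup +-abelianGroup using (⁻¹-anti-homo‿-)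
  open import Algebra.Properties.Group +-group using (⁻¹-involutive)
  open import Algebra.Solver.Ring.NaturalCoefficients.Default commutativeSemiring using (solve; _:=_; _:+_; _:*_; con)
  open import Relation.Binary.Reasoning.Setoid setoid

  -- ξ and η of the factorisation; only their values at positive indices matter.
  w-odd w-even : Idx → Carrier
  w-odd (pos j) = if isOdd j then 1# else u
  w-odd _ = 1#
  w-even (pos j) = if isOdd j then u else 1#
  w-even _ = 1#

  open AlternatingExpansion R {X = Idx} using (alt)
  open FactorisedPfaffian R u w-odd w-even

  a-pos-factorised : ∀ {i j} → i ℕ.< j →
    a (pos i) (pos j) ≈ w-even (pos i) * w-odd (pos j) + w-odd (pos i) * w-even (pos j)
  a-pos-factorised {i} {j} i<j with i ℕ.<ᵇ j | ℕₚ.<⇒<ᵇ i<j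
  ... | true | _ rewrite isOdd-∸ (ℕₚ.<⇒≤ i<j) with isOdd i | isOdd j
  ...   | true  | true  = solve 1 (λ u → (con 1 :+ con 1) :* u := u :* con 1 :+ con 1 :* u) refl u
  ...   | true  | false = solve 1 (λ u → con 1 :+ u :* u := u :* u :+ con 1 :* con 1) refl u
  ...   | false | true  = solve 1 (λ u → con 1 :+ u :* u := con 1 :* con 1 :+ u :* u) refl u
  ...   | false | false = solve 1 (λ u → (con 1 :+ con 1) :* u := con 1 :* u :+ u :* con 1) refl u

  staircase-factorised : ∀ k {n} {ν : Vec ℕ n} → AllPairs ℕ._≤_ ν → Factorised (staircase k ν)
  staircase-factorised k [] = []
  staircase-factorised k {ν = _ ∷ ν} (a≤ν ∷ sorted) =
    All.map (λ {s} → above⇒factorised s) (staircase-above k ν a≤ν ℕₚ.≤-refl) ∷ staircase-factorised (suc k) sorted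
    where
      above⇒factorised : ∀ {i} s → Above i s → a (pos i) s ≈ w-even (pos i) * w-odd s + w-odd (pos i) * w-even s
      above⇒factorised (pos j) i<j = a-pos-factorised i<j

  row-o : ∀ {n} {L : Vec Idx n} → All (Above 0) L → Row o 1# 1# L
  row-o = All.map (λ {s} → entry s)
    where
      entry : ∀ s → Above 0 s → a o s ≈ 1# * w-odd s + 1# * w-even s
      entry (pos j) _ with isOdd j
      ... | true  = solve 1 (λ u → con 1 :+ u := con 1 :* con 1 :+ con 1 :* u) refl u
      ... | false = solve 1 (λ u → con 1 :+ u := con 1 :* u :+ con 1 :* con 1) refl u

  row-o' : ∀ {n} {L : Vec Idx n} → All (Above 0) L → Row o' 1# (- 1#) L
  row-o' = All.map (λ {s} → entry s)
    where
      entry : ∀ s → Above 0 s → a o' s ≈ 1# * w-odd s + - 1# * w-even s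
      entry (pos (suc j)) _ with isOdd j
      ... | true  = trans (⁻¹-anti-homo‿- 1# u) (+-cong (sym (*-identityˡ u)) (sym (*-identityʳ (- 1#))))
      ... | false = +-cong (sym (*-identityˡ 1#)) (sym (-1*x≈-x u))

  private
    weight-odd : ∀ p b m → (if p xor b then 1# else u) * u ^ m ≈ u ^ ((if does (p Bool.≟ b) then suc else id) m)
    weight-odd true  true  m = refl
    weight-odd true  false m = *-identityˡ _
    weight-odd false true  m = *-identityˡ _
    weight-odd false false m = refl

    weight-even : ∀ p b m → (if p xor not b then u else 1#) * u ^ m ≈ u ^ ((if does (p Bool.≟ b) then suc else id) m)
    weight-even true  true  m = refl
    weight-even true  false m = *-identityˡ _
    weight-even false true  m = *-identityˡ _
    weight-even false false m = refl

  alt-w-odd-staircase  : ∀ k b {n} (ν : Vec ℕ n) → isOdd k ≡ b →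
                         alt w-odd w-even (staircase k ν) ≈ u ^ count (λ a → isOdd a Bool.≟ b) ν
  alt-w-even-staircase : ∀ k b {n} (ν : Vec ℕ n) → isOdd k ≡ not b →
                         alt w-even w-odd (staircase k ν) ≈ u ^ count (λ a → isOdd a Bool.≟ b) ν
  alt-w-odd-staircase k b [] _ = refl
  alt-w-odd-staircase k b (a ∷ ν) k≡b rewrite isOdd-+ a k | k≡b =
    trans (*-congˡ (alt-w-even-staircase (suc k) b ν (≡.cong not k≡b))) (weight-odd (isOdd a) b _)
  alt-w-even-staircase k b [] _ = refl
  alt-w-even-staircase k b (a ∷ ν) k≡¬b rewrite isOdd-+ a k | k≡¬b =
    trans (*-congˡ (alt-w-odd-staircase (suc k) b ν (≡.trans (≡.cong not k≡¬b) (not-involutive b))))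
          (weight-even (isOdd a) b _)

  module _ {n} (μ : Vec ℕ n) where

    I-factorised : IsPartition μ → Factorised (I μ)
    I-factorised isP = ≡.subst Factorised (≡.sym (I≡staircase μ))
      (staircase-factorised 1 (AllPairs-reverse (partition⇒antitone {μ = μ} isP)))

    I-positive : All (Above 0) (I μ)
    I-positive = ≡.subst (All (Above 0)) (≡.sym (I≡staircase μ))
      (staircase-above 0 (reverse μ) (All.universal (λ _ → z≤n) (reverse μ)) z≤n)

    alt-w-odd-I : alt w-odd w-even (I μ) ≈ u ^ oddCount μ
    alt-w-odd-I = begin
      alt w-odd w-even (I μ)                               ≡⟨ ≡.cong (alt w-odd w-even) (I≡staircase μ) ⟩
      alt w-odd w-even (staircase 1 (reverse μ))           ≈⟨ alt-w-odd-staircase 1 true (reverse μ) ≡.refl ⟩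
      u ^ count (λ a → isOdd a Bool.≟ true) (reverse μ)    ≡⟨ ≡.cong (u ^_) (count-reverse _ μ) ⟩
      u ^ oddCount μ                                       ∎

    alt-w-even-I : alt w-even w-odd (I μ) ≈ u ^ (n ℕ.∸ oddCount μ)
    alt-w-even-I = begin
      alt w-even w-odd (I μ)                               ≡⟨ ≡.cong (alt w-even w-odd) (I≡staircase μ) ⟩
      alt w-even w-odd (staircase 1 (reverse μ))           ≈⟨ alt-w-even-staircase 1 false (reverse μ) ≡.refl ⟩
      u ^ count (λ a → isOdd a Bool.≟ false) (reverse μ)   ≡⟨ ≡.cong (u ^_) (count-reverse _ μ) ⟩
      u ^ count (λ a → isOdd a Bool.≟ false) μ            ≡⟨ ≡.cong (u ^_) evenCount ⟩
      u ^ (n ℕ.∸ oddCount μ)                               ∎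
      where
        evenCount : count (λ a → isOdd a Bool.≟ false) μ ≡ n ℕ.∸ oddCount μ
        evenCount = ≡.trans (≡.sym (ℕₚ.m+n∸m≡n (oddCount μ) _))
                            (≡.cong (ℕ._∸ oddCount μ) (count-true+count-false isOdd μ))

  Pf-I : ∀ h {n} → double (suc h) ≡ n → (μ : Vec ℕ n) → IsPartition μ →
         Pf (I μ) ≈ two ^ h * (u ^ oddCount μ + u ^ (n ℕ.∸ oddCount μ))
  Pf-I h ≡.refl μ isP = trans (Pf-even h (I μ) (I-factorised μ isP))
    (*-congˡ (+-cong (alt-w-odd-I μ) (alt-w-even-I μ)))

  Pf-o∷I : ∀ h {n} → suc (double h) ≡ n → (μ : Vec ℕ n) → IsPartition μ →
           Pf (o ∷ I μ) ≈ two ^ h * (u ^ oddCount μ + u ^ (n ℕ.∸ oddCount μ))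
  Pf-o∷I h ≡.refl μ isP = trans (Pf-row h (I μ) (I-factorised μ isP) (row-o (I-positive μ)))
    (*-congˡ (+-cong (trans (*-identityˡ _) (alt-w-odd-I μ)) (trans (*-identityˡ _) (alt-w-even-I μ))))

  Pf-o'∷I : ∀ h {n} → suc (double h) ≡ n → (μ : Vec ℕ n) → IsPartition μ →
            Pf (o' ∷ I μ) ≈ two ^ h * (u ^ oddCount μ - u ^ (n ℕ.∸ oddCount μ))
  Pf-o'∷I h ≡.refl μ isP = trans (Pf-row h (I μ) (I-factorised μ isP) (row-o' (I-positive μ)))
    (*-congˡ (+-cong (trans (*-identityˡ _) (alt-w-odd-I μ)) (trans (-1*x≈-x _) (-‿cong (alt-w-even-I μ)))))

  Pf-o∷o'∷I : ∀ h {n} → double h ≡ n → (μ : Vec ℕ n) → IsPartition μ →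
             Pf (o ∷ o' ∷ I μ) ≈ two ^ h * (u ^ oddCount μ - u ^ (n ℕ.∸ oddCount μ))
  Pf-o∷o'∷I zero ≡.refl [] _ = trans (+-identityʳ _) (*-congˡ (trans (zeroˡ 1#) (sym (-‿inverseʳ 1#))))
  Pf-o∷o'∷I (suc h) ≡.refl μ isP = begin
    Pf (o ∷ o' ∷ I μ)
      ≈⟨ Pf-pair h {r = o} {r' = o'} (I μ) refl (I-factorised μ isP) (row-o (I-positive μ)) (row-o' (I-positive μ)) ⟩
    two ^ h * ((1# * 1# - 1# * - 1#) * (alt w-odd w-even (I μ) - alt w-even w-odd (I μ)))
      ≈⟨ *-congˡ (*-cong 1*1-1*-1≈two (+-cong (alt-w-odd-I μ) (-‿cong (alt-w-even-I μ)))) ⟩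
    two ^ h * (two * (u ^ oddCount μ - u ^ (double (suc h) ℕ.∸ oddCount μ)))
      ≈⟨ solve 3 (λ p t D → p :* (t :* D) := t :* p :* D) refl _ _ _ ⟩
    two ^ suc h * (u ^ oddCount μ - u ^ (double (suc h) ℕ.∸ oddCount μ)) ∎
    where
      1*1-1*-1≈two : 1# * 1# - 1# * - 1# ≈ two
      1*1-1*-1≈two = +-cong (*-identityˡ 1#) (trans (-‿cong (*-identityˡ (- 1#))) (⁻¹-involutive 1#))

proposition3p4 : ∀ {c ℓ : Level} (R : CommutativeRing c ℓ) (u : CommutativeRing.Carrier R) →
    let open CommutativeRing R
        open Matrix R u
    in ((h : ℕ) → 1 ℕ.≤ h → (μ : Vec ℕ (2 ℕ.* h)) → IsPartition μ →
          Pf (I μ) ≈ (two ^ (h ℕ.∸ 1)) * ((u ^ oddCount μ) + (u ^ (2 ℕ.* h ℕ.∸ oddCount μ))))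
     × ((h : ℕ) → (μ : Vec ℕ (2 ℕ.* h)) → IsPartition μ →
          Pf (o ∷ o' ∷ I μ) ≈ (two ^ h) * ((u ^ oddCount μ) - (u ^ (2 ℕ.* h ℕ.∸ oddCount μ))))
     × ((h : ℕ) → (μ : Vec ℕ (2 ℕ.* h ℕ.+ 1)) → IsPartition μ →
          Pf (o ∷ I μ) ≈ (two ^ h) * ((u ^ oddCount μ) + (u ^ (2 ℕ.* h ℕ.+ 1 ℕ.∸ oddCount μ))))
     × ((h : ℕ) → (μ : Vec ℕ (2 ℕ.* h ℕ.+ 1)) → IsPartition μ →
          Pf (o' ∷ I μ) ≈ (two ^ h) * ((u ^ oddCount μ) - (u ^ (2 ℕ.* h ℕ.+ 1 ℕ.∸ oddCount μ))))
proposition3p4 R u =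
    (λ { (suc h) _ → Pf-I h (double≡2* (suc h)) })
  , (λ h → Pf-o∷o'∷I h (double≡2* h))
  , (λ h → Pf-o∷I h (odd-length h))
  , (λ h → Pf-o'∷I h (odd-length h))
  where
    open StaircaseMinors R u
    odd-length : ∀ h → suc (double h) ≡ 2 ℕ.* h ℕ.+ 1
    odd-length h = ≡.trans (≡.cong suc (double≡2* h)) (ℕₚ.+-comm 1 (2 ℕ.* h))
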